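{- Let $S \subseteq \mathbb{Z}^n$ be an integrally convex set. For any face $F$ of the polyhedron $\overline{S}$, the set $F \cap \mathbb{Z}^n$ is integrally convex.
   Context: For $T \subseteq \mathbb{R}^n$, $\overline{T}$ denotes the convex hull of $T$. For $x \in \mathbb{R}^n$, $N(x) = \{ z \in \mathbb{Z}^n \mid |x_i - z_i| < 1 \ (i=1,\dots,n)\}$. A nonempty set $S \subseteq \mathbb{Z}^n$ is called integrally convex if $\overline{S} = \bigcup_{x \in \mathbb{R}^n} \overline{S \cap N(x)}$; equivalently, if every $x \in \overline{S}$ satisfies $x \in \overline{S \cap N(x)}$. (The convex hull of an integrally convex set is an integer polyhedron.)
   Formalization: The points x in the definition of integral convexity lie in ℚ^n rather than $\mathbb{R}^n$, convex hulls consist of rational points, and faces of $\overline{S}$ are cut out by rational valid inequalities. -}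

module Defs where

open import Data.Nat using (ℕ; zero; suc)
open import Data.Integer using (ℤ)
open import Data.Fin using (Fin; zero; suc)
open import Data.Rational using (ℚ; 0ℚ; 1ℚ; _+_; _*_; _-_; _≤_; _<_; ∣_∣; _/_)
open import Data.Product using (Σ; ∃; _×_; _,_)
open import Relation.Binary.PropositionalEquality using (_≡_)

ZSet : ℕ → Set₁
ZSet n = (Fin n → ℤ) → Set

ι : ℤ → ℚ
ι z = z / 1

ιv : {n : ℕ} → (Fin n → ℤ) → (Fin n → ℚ)
ιv z i = ι (z i)

Σ[_] : (m : ℕ) → (Fin m → ℚ) → ℚ
Σ[ zero ] f = 0ℚ
Σ[ suc m ] f = f zero + Σ[ m ] (λ k → f (suc k))

dot : {n : ℕ} → (Fin n → ℚ) → (Fin n → ℚ) → ℚ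
dot {n} c x = Σ[ n ] (λ i → c i * x i)

InHull : {n : ℕ} → ZSet n → (Fin n → ℚ) → Set
InHull {n} T x =
  Σ ℕ λ m → Σ (Fin m → ℚ) λ w → Σ (Fin m → Fin n → ℤ) λ zs →
    (∀ k → 0ℚ ≤ w k) × (∀ k → T (zs k)) × (Σ[ m ] w ≡ 1ℚ) ×
    (∀ i → x i ≡ Σ[ m ] (λ k → w k * ι (zs k i)))

InN : {n : ℕ} → (Fin n → ℚ) → (Fin n → ℤ) → Set
InN x z = ∀ i → ∣ x i - ι (z i) ∣ < 1ℚ

_∩N_ : {n : ℕ} → ZSet n → (Fin n → ℚ) → ZSet n
(S ∩N x) z = S z × InN x z

IntegrallyConvex : {n : ℕ} → ZSet n → Set
IntegrallyConvex S =
  (∃ λ z → S z) × (∀ x → InHull S x → InHull (S ∩N x) x)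

ValidIneq : {n : ℕ} → ZSet n → (Fin n → ℚ) → ℚ → Set
ValidIneq S c d = ∀ x → InHull S x → dot c x ≤ d

Face : {n : ℕ} → ZSet n → (Fin n → ℚ) → ℚ → (Fin n → ℚ) → Set
Face S c d x = InHull S x × dot c x ≡ d

FaceZ : {n : ℕ} → ZSet n → (Fin n → ℚ) → ℚ → ZSet n
FaceZ S c d z = Face S c d (ιv z)

{-# OPTIONS --safe #-}
-- Let y lie in the hull of F ∩ ℤⁿ. An integer point of conv S lies in S, since N(y) = {y} for
-- integral y; hence y ∈ conv S and c·y = d. Integral convexity writes y as a convex combination
-- of points of S ∩ N(y); as c·z ≤ d on S while the weighted average of c·z equals d, every point
-- of positive weight has c·z = d, i.e. lies in F ∩ ℤⁿ ∩ N(y). The same averaging argument,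
-- applied to any point of F, shows that F ∩ ℤⁿ is nonempty.
module Submission where

open import Defs
open import Data.Nat using (ℕ; zero; suc)
open import Data.Integer as ℤ using (ℤ; +0; +[1+_]; -[1+_])
import Data.Integer.Properties as ℤ
import Data.Nat.Properties as ℕ
import Data.Nat.Coprimality as Coprimality
open import Data.Rational
  using (ℚ; mkℚ; 0ℚ; 1ℚ; _+_; _*_; _-_; -_; _≤_; _<_; ∣_∣; _/_; *<*; positive; nonNegative)
open import Data.Rational.Properties
open import Data.Fin using (Fin; zero; suc)
open import Data.Fin.Properties using (¬∀⟶∃¬)
open import Data.Product using (∃; _×_; _,_; proj₁; proj₂)
open import Function using (_∘_)
open import Relation.Binary.PropositionalEquality
open import Relation.Nullary using (¬_; yes; no)
open import Algebra.Bundles using (CommutativeRing; CommutativeMonoid)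
open import Algebra.Properties.Semiring.Sum (CommutativeRing.semiring +-*-commutativeRing)
  using (sum; sum-replicate-zero; ∑-comm; *-distribˡ-sum; *-distribʳ-sum)
open import Algebra.Properties.CommutativeSemigroup
  (CommutativeMonoid.commutativeSemigroup *-1-commutativeMonoid) using (x∙yz≈y∙xz)

Σ≡sum : ∀ m (f : Fin m → ℚ) → Σ[ m ] f ≡ sum f
Σ≡sum zero    f = refl
Σ≡sum (suc m) f = cong (f zero +_) (Σ≡sum m (f ∘ suc))

Σ-cong : ∀ m {f g : Fin m → ℚ} → f ≗ g → Σ[ m ] f ≡ Σ[ m ] g
Σ-cong zero    f≗g = refl
Σ-cong (suc m) f≗g = cong₂ _+_ (f≗g zero) (Σ-cong m (f≗g ∘ suc))

Σ-distribˡ : ∀ m a (f : Fin m → ℚ) → a * Σ[ m ] f ≡ Σ[ m ] (λ k → a * f k)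
Σ-distribˡ m a f =
  trans (cong (a *_) (Σ≡sum m f)) (trans (*-distribˡ-sum a f) (sym (Σ≡sum m _)))

Σ-comm : ∀ n m (f : Fin n → Fin m → ℚ) →
  Σ[ n ] (λ i → Σ[ m ] (f i)) ≡ Σ[ m ] (λ k → Σ[ n ] (λ i → f i k))
Σ-comm n m f = trans (Σ²≡sum² n m f) (trans (∑-comm f) (sym (Σ²≡sum² m n (λ k i → f i k))))
  where
  Σ²≡sum² : ∀ n m (g : Fin n → Fin m → ℚ) → Σ[ n ] (λ i → Σ[ m ] (g i)) ≡ sum (λ i → sum (g i))
  Σ²≡sum² n m g = trans (Σ-cong n (λ i → Σ≡sum m (g i))) (Σ≡sum n _)

Σ-mono-≤ : ∀ m {f g : Fin m → ℚ} → (∀ k → f k ≤ g k) → Σ[ m ] f ≤ Σ[ m ] g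
Σ-mono-≤ zero    f≤g = ≤-refl
Σ-mono-≤ (suc m) f≤g = +-mono-≤ (f≤g zero) (Σ-mono-≤ m (f≤g ∘ suc))

Σ-mono-< : ∀ m {f g : Fin m → ℚ} → (∀ k → f k ≤ g k) → ∀ j → f j < g j → Σ[ m ] f < Σ[ m ] g
Σ-mono-< (suc m) f≤g zero    fj<gj = +-mono-<-≤ fj<gj (Σ-mono-≤ m (f≤g ∘ suc))
Σ-mono-< (suc m) f≤g (suc j) fj<gj = +-mono-≤-< (f≤g zero) (Σ-mono-< m (f≤g ∘ suc) j fj<gj)

combination : ∀ {m n} → (Fin m → ℚ) → (Fin m → Fin n → ℚ) → Fin n → ℚ
combination {m} w xs i = Σ[ m ] (λ k → w k * xs k i)

weightedSum-const : ∀ m (w : Fin m → ℚ) a → Σ[ m ] w ≡ 1ℚ → Σ[ m ] (λ k → w k * a) ≡ a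
weightedSum-const m w a Σw≡1 = begin
  Σ[ m ] (λ k → w k * a)  ≡⟨ Σ≡sum m _ ⟩
  sum (λ k → w k * a)     ≡⟨ sym (*-distribʳ-sum a w) ⟩
  sum w * a               ≡⟨ cong (_* a) (trans (sym (Σ≡sum m w)) Σw≡1) ⟩
  1ℚ * a                  ≡⟨ *-identityˡ a ⟩
  a                       ∎
  where open ≡-Reasoning

positiveWeight : ∀ m (w : Fin m → ℚ) → Σ[ m ] w ≡ 1ℚ → ∃ λ k → 0ℚ < w k
positiveWeight m w Σw≡1 with ¬∀⟶∃¬ m (λ k → w k ≤ 0ℚ) (λ k → w k ≤? 0ℚ) not-all≤0
  where
  not-all≤0 : ¬ (∀ k → w k ≤ 0ℚ)
  not-all≤0 w≤0 = <-irrefl refl (begin-strict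
    1ℚ                 ≡⟨ sym Σw≡1 ⟩
    Σ[ m ] w           ≤⟨ Σ-mono-≤ m w≤0 ⟩
    Σ[ m ] (λ _ → 0ℚ)  ≡⟨ trans (Σ≡sum m _) (sum-replicate-zero m) ⟩
    0ℚ                 <⟨ positive⁻¹ 1ℚ ⟩
    1ℚ                 ∎)
    where open ≤-Reasoning
... | k , wk≰0 = k , ≰⇒> wk≰0

weightedSum-tight : ∀ m (w a : Fin m → ℚ) d → (∀ k → 0ℚ ≤ w k) → Σ[ m ] w ≡ 1ℚ →
  (∀ k → a k ≤ d) → Σ[ m ] (λ k → w k * a k) ≡ d → ∀ j → 0ℚ < w j → a j ≡ d
weightedSum-tight m w a d w≥0 Σw≡1 a≤d avg≡d j wj>0 = ≤-antisym (a≤d j) (≮⇒≥ aj≮d)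
  where
  aj≮d : ¬ (a j < d)
  aj≮d aj<d = <-irrefl refl (begin-strict
    d                        ≡⟨ sym avg≡d ⟩
    Σ[ m ] (λ k → w k * a k) <⟨ Σ-mono-< m wa≤wd j (*-monoʳ-<-pos (w j) {{positive wj>0}} aj<d) ⟩
    Σ[ m ] (λ k → w k * d)   ≡⟨ weightedSum-const m w d Σw≡1 ⟩
    d                        ∎)
    where
    open ≤-Reasoning
    wa≤wd : ∀ k → w k * a k ≤ w k * d
    wa≤wd k = *-monoˡ-≤-nonNeg (w k) {{nonNegative (w≥0 k)}} (a≤d k)

dot-combination : ∀ {m n} (c : Fin n → ℚ) (w : Fin m → ℚ) (xs : Fin m → Fin n → ℚ) →
  dot c (combination w xs) ≡ Σ[ m ] (λ k → w k * dot c (xs k))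
dot-combination {m} {n} c w xs = begin
  Σ[ n ] (λ i → c i * Σ[ m ] (λ k → w k * xs k i))
    ≡⟨ Σ-cong n (λ i → Σ-distribˡ m (c i) _) ⟩
  Σ[ n ] (λ i → Σ[ m ] (λ k → c i * (w k * xs k i)))
    ≡⟨ Σ-comm n m _ ⟩
  Σ[ m ] (λ k → Σ[ n ] (λ i → c i * (w k * xs k i)))
    ≡⟨ Σ-cong m (λ k → Σ-cong n (λ i → x∙yz≈y∙xz (c i) (w k) _)) ⟩
  Σ[ m ] (λ k → Σ[ n ] (λ i → w k * (c i * xs k i)))
    ≡⟨ Σ-cong m (λ k → sym (Σ-distribˡ n (w k) _)) ⟩
  Σ[ m ] (λ k → w k * dot c (xs k))
    ∎
  where open ≡-Reasoning

dot-cong : ∀ {n} (c : Fin n → ℚ) {x y : Fin n → ℚ} → x ≗ y → dot c x ≡ dot c y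
dot-cong {n} c x≗y = Σ-cong n (λ i → cong (c i *_) (x≗y i))

-- ι a = a / 1 goes through normalize and does not compute for a variable a; its normal form
-- mkℚ/1 a does, which is what makes the subtraction below reduce.
mkℚ/1 : ℤ → ℚ
mkℚ/1 a = mkℚ a 0 (Coprimality.sym (Coprimality.1-coprimeTo ℤ.∣ a ∣))

ι≡mkℚ/1 : ∀ a → ι a ≡ mkℚ/1 a
ι≡mkℚ/1 a = ↥p/↧p≡p (mkℚ/1 a)

ιa-ιb≡ι[a-b] : ∀ a b → ι a - ι b ≡ ι (a ℤ.- b)
ιa-ιb≡ι[a-b] a b = begin
  ι a - ι b                         ≡⟨ cong₂ _-_ (ι≡mkℚ/1 a) (ι≡mkℚ/1 b) ⟩
  mkℚ/1 a - mkℚ/1 b                 ≡⟨ cong (mkℚ/1 a +_) (neg-mkℚ/1 b) ⟩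
  (a ℤ.* ℤ.1ℤ ℤ.+ ℤ.- b ℤ.* ℤ.1ℤ) / 1
    ≡⟨ cong (_/ 1) (cong₂ ℤ._+_ (ℤ.*-identityʳ a) (ℤ.*-identityʳ (ℤ.- b))) ⟩
  ι (a ℤ.- b)                       ∎
  where
  open ≡-Reasoning
  neg-mkℚ/1 : ∀ b → - mkℚ/1 b ≡ mkℚ/1 (ℤ.- b)
  neg-mkℚ/1 +0       = refl
  neg-mkℚ/1 +[1+ _ ] = refl
  neg-mkℚ/1 -[1+ _ ] = refl

∣ι∣<1⇒≡0 : ∀ a → ∣ ι a ∣ < 1ℚ → a ≡ +0
∣ι∣<1⇒≡0 a ∣ιa∣<1 with *<* ∣a∣*1<1 ← subst (λ q → ∣ q ∣ < 1ℚ) (ι≡mkℚ/1 a) ∣ιa∣<1 =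
  ℤ.∣i∣≡0⇒i≡0 (ℕ.n<1⇒n≡0 (ℤ.drop‿+<+ (subst (ℤ._< ℤ.+ 1) (ℤ.*-identityʳ _) ∣a∣*1<1)))

ι-close⇒≡ : ∀ a b → ∣ ι a - ι b ∣ < 1ℚ → a ≡ b
ι-close⇒≡ a b close =
  ℤ.i-j≡0⇒i≡j a b (∣ι∣<1⇒≡0 (a ℤ.- b) (subst (λ q → ∣ q ∣ < 1ℚ) (ιa-ιb≡ι[a-b] a b) close))

InN-ιv⇒≗ : ∀ {n} {y z : Fin n → ℤ} → InN (ιv y) z → z ≗ y
InN-ιv⇒≗ {y = y} {z} z∈N i = sym (ι-close⇒≡ (y i) (z i) (z∈N i))

module _ {n : ℕ} where

  hull-singleton : ∀ (T : ZSet n) z → T z → InHull T (ιv z)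
  hull-singleton T z z∈T =
    1 , (λ _ → 1ℚ) , (λ _ → z) , (λ _ → nonNegative⁻¹ 1ℚ) , (λ _ → z∈T) , +-identityʳ 1ℚ ,
    (λ i → sym (trans (+-identityʳ _) (*-identityˡ _)))

  hull-fromSupport : ∀ {T : ZSet n} {x} m (w : Fin m → ℚ) (zs : Fin m → Fin n → ℤ) →
    (∀ k → 0ℚ ≤ w k) → Σ[ m ] w ≡ 1ℚ → x ≗ combination w (ιv ∘ zs) →
    (∀ k → 0ℚ < w k → T (zs k)) → InHull T x
  hull-fromSupport {T} m w zs w≥0 Σw≡1 x≗ support⊆T
    with j₀ , wj₀>0 ← positiveWeight m w Σw≡1 =
    m , w , zs′ , w≥0 , zs′∈T , Σw≡1 , (λ i → trans (x≗ i) (Σ-cong m (λ k → same-term k i)))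
    where
    zs′ : Fin m → Fin n → ℤ
    zs′ k with 0ℚ <? w k
    ... | yes _ = zs k
    ... | no _  = zs j₀
    zs′∈T : ∀ k → T (zs′ k)
    zs′∈T k with 0ℚ <? w k
    ... | yes wk>0 = support⊆T k wk>0
    ... | no _     = support⊆T j₀ wj₀>0
    same-term : ∀ k i → w k * ι (zs k i) ≡ w k * ι (zs′ k i)
    same-term k i with 0ℚ <? w k
    ... | yes _ = refl
    ... | no wk≯0 rewrite ≤-antisym (≮⇒≥ wk≯0) (w≥0 k) =
      trans (*-zeroˡ (ι (zs k i))) (sym (*-zeroˡ (ι (zs j₀ i))))

  hull-mono-≗ : ∀ {T S : ZSet n} → (∀ {z} → T z → ∃ λ s → S s × s ≗ z) →
    ∀ {x} → InHull T x → InHull S x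
  hull-mono-≗ {T} {S} T⊆S (m , w , zs , w≥0 , zs∈T , Σw≡1 , x≗) =
    m , w , proj₁ ∘ rep , w≥0 , proj₁ ∘ proj₂ ∘ rep , Σw≡1 ,
    (λ i → trans (x≗ i) (Σ-cong m (λ k → cong (λ t → w k * ι t) (sym (proj₂ (proj₂ (rep k)) i)))))
    where
    rep : ∀ k → ∃ λ s → S s × s ≗ zs k
    rep k = T⊆S (zs∈T k)

  dot-onHull : ∀ {T : ZSet n} (c : Fin n → ℚ) d → (∀ {z} → T z → dot c (ιv z) ≡ d) →
    ∀ {x} → InHull T x → dot c x ≡ d
  dot-onHull c d onT {x} (m , w , zs , _ , zs∈T , Σw≡1 , x≗) = begin
    dot c x                                   ≡⟨ dot-cong c x≗ ⟩
    dot c (combination w (ιv ∘ zs))           ≡⟨ dot-combination c w (ιv ∘ zs) ⟩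
    Σ[ m ] (λ k → w k * dot c (ιv (zs k)))    ≡⟨ Σ-cong m (λ k → cong (w k *_) (onT (zs∈T k))) ⟩
    Σ[ m ] (λ k → w k * d)                    ≡⟨ weightedSum-const m w d Σw≡1 ⟩
    d                                         ∎
    where open ≡-Reasoning

  integerPoint-inHull : ∀ {S : ZSet n} → IntegrallyConvex S →
    ∀ {y} → InHull S (ιv y) → ∃ λ z → S z × z ≗ y
  integerPoint-inHull (_ , local) {y} y∈hull
    with m , w , zs , _ , zs∈S∩N , Σw≡1 , _ ← local (ιv y) y∈hull
    with j , _ ← positiveWeight m w Σw≡1 =
    zs j , proj₁ (zs∈S∩N j) , InN-ιv⇒≗ (proj₂ (zs∈S∩N j))

module _ {n : ℕ} (S : ZSet n) (c : Fin n → ℚ) (d : ℚ) (valid : ValidIneq S c d) where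

  support-inFace : ∀ {x} m (w : Fin m → ℚ) (zs : Fin m → Fin n → ℤ) →
    (∀ k → 0ℚ ≤ w k) → (∀ k → S (zs k)) → Σ[ m ] w ≡ 1ℚ → x ≗ combination w (ιv ∘ zs) →
    dot c x ≡ d → ∀ j → 0ℚ < w j → FaceZ S c d (zs j)
  support-inFace m w zs w≥0 zs∈S Σw≡1 x≗ cx≡d j wj>0 =
    hull-singleton S (zs j) (zs∈S j) ,
    weightedSum-tight m w (λ k → dot c (ιv (zs k))) d w≥0 Σw≡1
      (λ k → valid _ (hull-singleton S (zs k) (zs∈S k)))
      (trans (sym (trans (dot-cong c x≗) (dot-combination c w (ιv ∘ zs)))) cx≡d) j wj>0

  face-hasIntegerPoint : ∀ {x} → Face S c d x → ∃ (FaceZ S c d)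
  face-hasIntegerPoint ((m , w , zs , w≥0 , zs∈S , Σw≡1 , x≗) , cx≡d)
    with j , wj>0 ← positiveWeight m w Σw≡1 =
    zs j , support-inFace m w zs w≥0 zs∈S Σw≡1 x≗ cx≡d j wj>0

  face-inHull∩N : IntegrallyConvex S →
    ∀ y → InHull S y → dot c y ≡ d → InHull (FaceZ S c d ∩N y) y
  face-inHull∩N (_ , local) y y∈hullS cy≡d
    with m , w , zs , w≥0 , zs∈S∩N , Σw≡1 , y≗ ← local y y∈hullS =
    hull-fromSupport {T = FaceZ S c d ∩N y} m w zs w≥0 Σw≡1 y≗ (λ k wk>0 →
      support-inFace m w zs w≥0 (proj₁ ∘ zs∈S∩N) Σw≡1 y≗ cy≡d k wk>0 , proj₂ (zs∈S∩N k))

  faceZ-hull⊆hull∩N : IntegrallyConvex S →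
    ∀ y → InHull (FaceZ S c d) y → InHull (FaceZ S c d ∩N y) y
  faceZ-hull⊆hull∩N icS y y∈hullF = face-inHull∩N icS y
    (hull-mono-≗ {T = FaceZ S c d} (λ (z∈hull , _) → integerPoint-inHull icS z∈hull) y∈hullF)
    (dot-onHull {T = FaceZ S c d} c d (λ (_ , cz≡d) → cz≡d) y∈hullF)

proposition2p5 : (n : ℕ) (S : ZSet n) → IntegrallyConvex S →
    (c : Fin n → ℚ) (d : ℚ) → ValidIneq S c d → (∃ λ x → Face S c d x) →
    IntegrallyConvex (FaceZ S c d)
proposition2p5 n S icS c d valid (_ , x∈F) =
  face-hasIntegerPoint S c d valid x∈F , faceZ-hull⊆hull∩N S c d valid icS
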